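{- If $\sigma\le\sigma'$ in $S_p$ and $\tau\le\tau'$ in $S_q$ (weak order), then $\sigma\vee\tau\le\sigma'\vee\tau'$ in $S_{p+q+1}$.
   Context: $S_n$: symmetric group on $\{1,\dots,n\}$ ($S_0$ has only the empty permutation), product $(\sigma\cdot\tau)(i)=\sigma(\tau(i))$, $s_i=(i\ i+1)$, $l$ the length with respect to the $s_i$. Weak order: $\omega\le\sigma$ iff $\sigma=\tau\cdot\omega$ for some $\tau$ with $l(\sigma)=l(\tau)+l(\omega)$. Grafting of $\sigma\in S_p,\tau\in S_q$: $\sigma\vee\tau\in S_{p+q+1}$, $(\sigma\vee\tau)(i)=\sigma(i)$ for $1\le i\le p$, $=p+q+1$ for $i=p+1$, $=\tau(i-p-1)+p$ for $p+2\le i\le p+q+1$. -}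

module Defs where

open import Data.Nat using (ℕ; zero; suc; _+_; _≤_; _<_)
open import Data.Fin using (Fin; zero; suc; toℕ; fromℕ; fromℕ<; inject₁; _↑ˡ_; _↑ʳ_; splitAt; _≟_)
open import Data.Sum using (inj₁; inj₂)
open import Data.Product using (Σ; ∃; ∃-syntax; _×_; _,_)
open import Data.List using (List; []; _∷_; length)
open import Relation.Nullary using (yes; no)
open import Relation.Binary.PropositionalEquality using (_≡_)
open import Function using (_∘_; id)

-- Elements of S_n are represented by functions Fin n → Fin n (0-based:
-- Fin n = {0,…,n-1} stands for {1,…,n}); membership in S_n is the
-- bijectivity of the function.
Fun : ℕ → Set
Fun n = Fin n → Fin n

infix 4 _≐_
_≐_ : ∀ {n} → Fun n → Fun n → Set
f ≐ g = ∀ i → f i ≡ g i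

swap : ∀ {n} → Fin n → Fin n → Fun n
swap a b x with x ≟ a
... | yes _ = b
... | no _ with x ≟ b
...   | yes _ = a
...   | no _ = x

-- Index of an adjacent transposition s_i: a position a with a+1 < n
-- (0-based), i.e. s_{a+1} in the paper's 1-based notation.
Gen : ℕ → Set
Gen n = Σ (Fin n) (λ a → suc (toℕ a) < n)

s : ∀ {n} → Gen n → Fun n
s (a , h) = swap a (fromℕ< h)

-- A word s_{i1} … s_{ik} evaluates to the product s_{i1} · … · s_{ik},
-- with (σ·τ)(i) = σ(τ(i)), i.e. function composition.
eval : ∀ {n} → List (Gen n) → Fun n
eval []      = id
eval (g ∷ w) = s g ∘ eval w

HasLength : ∀ {n} → Fun n → ℕ → Set
HasLength {n} σ k =
  (∃[ w ] (length w ≡ k × eval w ≐ σ)) ×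
  (∀ (w : List (Gen n)) → eval w ≐ σ → k ≤ length w)

infix 4 _≤w_
_≤w_ : ∀ {n} → Fun n → Fun n → Set
_≤w_ {n} ω σ =
  ∃[ τ ] ∃[ a ] ∃[ b ]
    (HasLength τ a × HasLength ω b × HasLength σ (a + b) × σ ≐ τ ∘ ω)

-- Grafting σ ∨ τ ∈ S_{p+q+1}, with p+q+1 written as p + suc q.
-- 1-based: i ≤ p ↦ σ(i); p+1 ↦ p+q+1; p+1+j ↦ τ(j)+p.
graft : ∀ {p q} → Fun p → Fun q → Fun (p + suc q)
graft {p} {q} σ τ i with splitAt p i
... | inj₁ j       = σ j ↑ˡ suc q
... | inj₂ zero    = p ↑ʳ fromℕ q
... | inj₂ (suc j) = p ↑ʳ inject₁ (τ j)

-- The length of a permutation is its number of inversions: an adjacent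
-- transposition changes the inversion number by at most one, swapping a descent
-- lowers it by exactly one, and the only injective map without inversions is the
-- identity. In one-line notation σ ∨ τ reads σ, then p + q, then τ shifted by p,
-- so l(σ ∨ τ) = l(σ) + q + l(τ). If σ′ = α σ and τ′ = β τ with additive lengths,
-- then σ′ ∨ τ′ = γ (σ ∨ τ) for the permutation γ = α ⊕ extend β acting as α on
-- the first p points, as β on the next q and fixing the last one. Its length is
-- l(α) + l(β), so the lengths add up again.
module Submission where

open import Defs
open import Data.Nat as ℕ using (ℕ; zero; suc; _+_; _≤_; _<_; z≤n; s≤s; s≤s⁻¹)
open import Data.Nat.Properties hiding (_≟_)
open import Data.Nat.Tactic.RingSolver using (solve-∀)
open import Data.Fin using (Fin; zero; suc; toℕ; fromℕ; inject₁; lower₁; _↑ˡ_; _↑ʳ_; splitAt; join; _≟_)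
open import Data.Fin.Properties
  using (toℕ-injective; toℕ<n; toℕ-↑ˡ; toℕ-↑ʳ; toℕ-fromℕ; toℕ-inject₁; toℕ-inject₁-≢;
         splitAt-↑ˡ; splitAt-↑ʳ; splitAt-join; join-splitAt; fromℕ≢inject₁; inject₁-injective;
         lower₁-injective; lower₁-inject₁′)
open import Data.List using (List; []; _∷_; _++_; _∷ʳ_; map; length; tabulate)
open import Data.List.Properties using (tabulate-cong; length-tabulate; map-tabulate; length-++)
open import Data.List.Relation.Unary.All as All using (All; []; _∷_)
import Data.List.Relation.Unary.All.Properties as All
open import Data.List.Relation.Unary.AllPairs as AllPairs using (AllPairs; []; _∷_)
import Data.List.Relation.Unary.AllPairs.Properties as AllPairs
import Data.List.Relation.Unary.Unique.Propositional.Properties as Unique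
open import Data.Product as Product using (Σ-syntax; ∃-syntax; _×_; _,_; proj₁; uncurry)
open import Data.Sum as Sum using (inj₁; inj₂)
open import Data.Sum.Properties using (inj₁-injective; inj₂-injective)
open import Function using (_∘_; id)
open import Function.Definitions using (Injective; Bijective)
open import Relation.Nullary using (Dec; yes; no; contradiction)
open import Relation.Binary.PropositionalEquality

private
  variable
    A B C D : Set
    n m p q : ℕ
    x y : ℕ
    xs ys : List ℕ

⟦_<_⟧ : ℕ → ℕ → ℕ
⟦ _     < zero  ⟧ = 0
⟦ zero  < suc _ ⟧ = 1
⟦ suc y < suc x ⟧ = ⟦ y < x ⟧

countBelow : ℕ → List ℕ → ℕ
countBelow x []       = 0
countBelow x (y ∷ ys) = ⟦ y < x ⟧ + countBelow x ys

inversions : List ℕ → ℕ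
inversions []       = 0
inversions (x ∷ xs) = countBelow x xs + inversions xs

⟦<⟧≡1 : y < x → ⟦ y < x ⟧ ≡ 1
⟦<⟧≡1 {zero}  {suc _} _         = refl
⟦<⟧≡1 {suc _} {suc _} (s≤s y<x) = ⟦<⟧≡1 y<x

⟦<⟧≡0 : x ≤ y → ⟦ y < x ⟧ ≡ 0
⟦<⟧≡0 {zero}          _         = refl
⟦<⟧≡0 {suc _} {suc _} (s≤s x≤y) = ⟦<⟧≡0 x≤y

⟦<⟧≡0⇒≥ : ∀ y x → ⟦ y < x ⟧ ≡ 0 → x ≤ y
⟦<⟧≡0⇒≥ _       zero    _ = z≤n
⟦<⟧≡0⇒≥ (suc y) (suc x) e = s≤s (⟦<⟧≡0⇒≥ y x e)

⟦<⟧≤1 : ∀ y x → ⟦ y < x ⟧ ≤ 1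
⟦<⟧≤1 _       zero    = z≤n
⟦<⟧≤1 zero    (suc _) = ≤-refl
⟦<⟧≤1 (suc y) (suc x) = ⟦<⟧≤1 y x

⟦+<+⟧ : ∀ p y x → ⟦ p + y < p + x ⟧ ≡ ⟦ y < x ⟧
⟦+<+⟧ zero    y x = refl
⟦+<+⟧ (suc p) y x = ⟦+<+⟧ p y x

countBelow-++ : ∀ x xs ys → countBelow x (xs ++ ys) ≡ countBelow x xs + countBelow x ys
countBelow-++ x []       ys = refl
countBelow-++ x (y ∷ xs) ys =
  trans (cong (⟦ y < x ⟧ +_) (countBelow-++ x xs ys)) (sym (+-assoc ⟦ y < x ⟧ _ _))

countBelow-map-+ : ∀ p x ys → countBelow (p + x) (map (p +_) ys) ≡ countBelow x ys
countBelow-map-+ p x []       = refl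
countBelow-map-+ p x (y ∷ ys) = cong₂ _+_ (⟦+<+⟧ p y x) (countBelow-map-+ p x ys)

countBelow-≤ : All (x ≤_) ys → countBelow x ys ≡ 0
countBelow-≤ []           = refl
countBelow-≤ (x≤y ∷ x≤ys) = cong₂ _+_ (⟦<⟧≡0 x≤y) (countBelow-≤ x≤ys)

countBelow≡0 : ∀ x ys → countBelow x ys ≡ 0 → All (x ≤_) ys
countBelow≡0 x []       _ = []
countBelow≡0 x (y ∷ ys) e =
  ⟦<⟧≡0⇒≥ y x (m+n≡0⇒m≡0 _ e) ∷ countBelow≡0 x ys (m+n≡0⇒n≡0 ⟦ y < x ⟧ e)

countBelow-< : All (_< x) ys → countBelow x ys ≡ length ys
countBelow-< []           = refl
countBelow-< (y<x ∷ ys<x) = cong₂ _+_ (⟦<⟧≡1 y<x) (countBelow-< ys<x)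

inversions-map-+ : ∀ p xs → inversions (map (p +_) xs) ≡ inversions xs
inversions-map-+ p []       = refl
inversions-map-+ p (x ∷ xs) = cong₂ _+_ (countBelow-map-+ p x xs) (inversions-map-+ p xs)

inversions-++ : All (_< p) xs → All (p ≤_) ys → inversions (xs ++ ys) ≡ inversions xs + inversions ys
inversions-++ {xs = []}                 _           _    = refl
inversions-++ {xs = x ∷ xs} {ys = ys} (x<p ∷ xs<p) p≤ys = begin
  countBelow x (xs ++ ys) + inversions (xs ++ ys)
    ≡⟨ cong₂ _+_ (countBelow-++ x xs ys) (inversions-++ xs<p p≤ys) ⟩
  (countBelow x xs + countBelow x ys) + (inversions xs + inversions ys)
    ≡⟨ cong (λ c → (countBelow x xs + c) + _) (countBelow-≤ (All.map (≤-trans (<⇒≤ x<p)) p≤ys)) ⟩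
  (countBelow x xs + 0) + (inversions xs + inversions ys)
    ≡⟨ cong (_+ _) (+-identityʳ (countBelow x xs)) ⟩
  countBelow x xs + (inversions xs + inversions ys)
    ≡⟨ +-assoc (countBelow x xs) _ _ ⟨
  countBelow x xs + inversions xs + inversions ys ∎
  where open ≡-Reasoning

sorted⇒inversions≡0 : AllPairs _≤_ xs → inversions xs ≡ 0
sorted⇒inversions≡0 []                = refl
sorted⇒inversions≡0 (x≤xs ∷ xs-sorted) = cong₂ _+_ (countBelow-≤ x≤xs) (sorted⇒inversions≡0 xs-sorted)

inversions≡0⇒sorted : ∀ xs → inversions xs ≡ 0 → AllPairs _≤_ xs
inversions≡0⇒sorted []       _ = []
inversions≡0⇒sorted (x ∷ xs) e =
  countBelow≡0 x xs (m+n≡0⇒m≡0 _ e) ∷ inversions≡0⇒sorted xs (m+n≡0⇒n≡0 (countBelow x xs) e)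

swapAt : ℕ → List A → List A
swapAt zero    (x ∷ y ∷ xs) = y ∷ x ∷ xs
swapAt (suc i) (x ∷ xs)     = x ∷ swapAt i xs
swapAt _       xs           = xs

data Descent : ℕ → List ℕ → Set where
  here  : ∀ {x y zs} → y < x → Descent zero (x ∷ y ∷ zs)
  there : ∀ {i x xs} → Descent i xs → Descent (suc i) (x ∷ xs)

countBelow-swapAt : ∀ x i ys → countBelow x (swapAt i ys) ≡ countBelow x ys
countBelow-swapAt x zero    (y ∷ z ∷ ys) = exchange ⟦ z < x ⟧ ⟦ y < x ⟧ (countBelow x ys)
  where
  exchange : ∀ a b c → a + (b + c) ≡ b + (a + c)
  exchange = solve-∀
countBelow-swapAt x zero    []           = refl
countBelow-swapAt x zero    (_ ∷ [])     = refl
countBelow-swapAt x (suc i) []           = refl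
countBelow-swapAt x (suc i) (y ∷ ys)     = cong (⟦ y < x ⟧ +_) (countBelow-swapAt x i ys)

inversions-swap-head : ∀ x y zs →
  inversions (y ∷ x ∷ zs) + ⟦ y < x ⟧ ≡ inversions (x ∷ y ∷ zs) + ⟦ x < y ⟧
inversions-swap-head x y zs =
  rearrange ⟦ x < y ⟧ ⟦ y < x ⟧ (countBelow y zs) (countBelow x zs) (inversions zs)
  where
  rearrange : ∀ a b c d e → (a + c) + (d + e) + b ≡ (b + d) + (c + e) + a
  rearrange = solve-∀

inversions-swapAt-≤ : ∀ i xs → inversions (swapAt i xs) ≤ suc (inversions xs)
inversions-swapAt-≤ zero (x ∷ y ∷ zs) = begin
  inversions (y ∷ x ∷ zs)               ≤⟨ m≤m+n _ ⟦ y < x ⟧ ⟩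
  inversions (y ∷ x ∷ zs) + ⟦ y < x ⟧   ≡⟨ inversions-swap-head x y zs ⟩
  inversions (x ∷ y ∷ zs) + ⟦ x < y ⟧   ≤⟨ +-monoʳ-≤ _ (⟦<⟧≤1 x y) ⟩
  inversions (x ∷ y ∷ zs) + 1           ≡⟨ +-comm _ 1 ⟩
  suc (inversions (x ∷ y ∷ zs))         ∎
  where open ≤-Reasoning
inversions-swapAt-≤ zero    []       = z≤n
inversions-swapAt-≤ zero    (_ ∷ []) = n≤1+n _
inversions-swapAt-≤ (suc i) []       = z≤n
inversions-swapAt-≤ (suc i) (x ∷ xs) = begin
  countBelow x (swapAt i xs) + inversions (swapAt i xs) ≡⟨ cong (_+ _) (countBelow-swapAt x i xs) ⟩
  countBelow x xs + inversions (swapAt i xs)            ≤⟨ +-monoʳ-≤ _ (inversions-swapAt-≤ i xs) ⟩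
  countBelow x xs + suc (inversions xs)                 ≡⟨ +-suc _ _ ⟩
  suc (countBelow x xs + inversions xs)                 ∎
  where open ≤-Reasoning

inversions-swapAt-descent : ∀ {i xs} → Descent i xs → suc (inversions (swapAt i xs)) ≡ inversions xs
inversions-swapAt-descent {xs = x ∷ y ∷ zs} (here y<x) = begin
  suc (inversions (y ∷ x ∷ zs))         ≡⟨ +-comm 1 _ ⟩
  inversions (y ∷ x ∷ zs) + 1           ≡⟨ cong (inversions (y ∷ x ∷ zs) +_) (⟦<⟧≡1 y<x) ⟨
  inversions (y ∷ x ∷ zs) + ⟦ y < x ⟧   ≡⟨ inversions-swap-head x y zs ⟩
  inversions (x ∷ y ∷ zs) + ⟦ x < y ⟧   ≡⟨ cong (inversions (x ∷ y ∷ zs) +_) (⟦<⟧≡0 (<⇒≤ y<x)) ⟩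
  inversions (x ∷ y ∷ zs) + 0           ≡⟨ +-identityʳ _ ⟩
  inversions (x ∷ y ∷ zs)               ∎
  where open ≡-Reasoning
inversions-swapAt-descent {suc i} {x ∷ xs} (there d) = begin
  suc (countBelow x (swapAt i xs) + inversions (swapAt i xs)) ≡⟨ +-suc _ _ ⟨
  countBelow x (swapAt i xs) + suc (inversions (swapAt i xs))
    ≡⟨ cong₂ _+_ (countBelow-swapAt x i xs) (inversions-swapAt-descent d) ⟩
  countBelow x xs + inversions xs                             ∎
  where open ≡-Reasoning

descent-at-head : ∀ x ys → AllPairs _≤_ ys → countBelow x ys ≢ 0 → Descent zero (x ∷ ys)
descent-at-head x []       _            cb≢0 = contradiction refl cb≢0
descent-at-head x (y ∷ ys) (y≤ys ∷ _)  cb≢0 with y ℕ.<? x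
... | yes y<x = here y<x
... | no  y≮x = contradiction (countBelow-≤ (x≤y ∷ All.map (≤-trans x≤y) y≤ys)) cb≢0
  where x≤y = ≮⇒≥ y≮x

descent-exists : ∀ xs → inversions xs ≢ 0 → ∃[ i ] Descent i xs
descent-exists []       inv≢0 = contradiction refl inv≢0
descent-exists (x ∷ xs) inv≢0 with inversions xs ℕ.≟ 0
... | no  xs-inv≢0 = Product.map suc there (descent-exists xs xs-inv≢0)
... | yes xs-inv≡0 = zero , descent-at-head x xs (inversions≡0⇒sorted xs xs-inv≡0)
                              (λ cb≡0 → inv≢0 (cong₂ _+_ cb≡0 xs-inv≡0))

tabulate-ascending⇒consecutive : ∀ {n} m (h : Fin n → ℕ) → AllPairs _<_ (tabulate h) →
  (∀ i → m ≤ h i) → (∀ i → h i < n + m) → ∀ i → h i ≡ toℕ i + m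
tabulate-ascending⇒consecutive {suc zero}    m h _             lo hi zero =
  ≤-antisym (s≤s⁻¹ (hi zero)) (lo zero)
tabulate-ascending⇒consecutive {suc (suc n)} m h (h₀<hs ∷ asc) lo hi = λ where
    zero    → ≤-antisym (s≤s⁻¹ (subst (h zero <_) (rest zero) (h₀<h₊ zero))) (lo zero)
    (suc i) → trans (rest i) (+-suc (toℕ i) m)
  where
  h₀<h₊ : ∀ i → h zero < h (suc i)
  h₀<h₊ = All.tabulate⁻ {f = h ∘ suc} h₀<hs
  rest : ∀ i → h (suc i) ≡ toℕ i + suc m
  rest = tabulate-ascending⇒consecutive (suc m) (h ∘ suc) asc
           (λ i → ≤-<-trans (lo zero) (h₀<h₊ i))
           (λ i → subst (h (suc i) <_) (sym (+-suc (suc n) m)) (hi (suc i)))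

oneLine : Fun n → List ℕ
oneLine σ = tabulate (toℕ ∘ σ)

inv : Fun n → ℕ
inv σ = inversions (oneLine σ)

oneLine<n : (σ : Fun n) → All (_< n) (oneLine σ)
oneLine<n σ = All.tabulate⁺ (toℕ<n ∘ σ)

inv-cong : {f g : Fun n} → f ≐ g → inv f ≡ inv g
inv-cong f≐g = cong inversions (tabulate-cong (cong toℕ ∘ f≐g))

Injective-resp-≐ : {f g : Fun n} → f ≐ g → Injective _≡_ _≡_ f → Injective _≡_ _≡_ g
Injective-resp-≐ {f = f} {g} f≐g f-inj {x} {y} gx≡gy = f-inj (begin
  f x ≡⟨ f≐g x ⟩ g x ≡⟨ gx≡gy ⟩ g y ≡⟨ f≐g y ⟨ f y ∎)
  where open ≡-Reasoning

inv-id : inv {n} id ≡ 0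
inv-id {n} = sorted⇒inversions≡0 (AllPairs.tabulate⁺-< {n = n} <⇒≤)

inv≡0⇒identity : {f : Fun n} → Injective _≡_ _≡_ f → inv f ≡ 0 → f ≐ id
inv≡0⇒identity {n} {f} f-inj inv≡0 i = toℕ-injective (begin
  toℕ (f i)     ≡⟨ tabulate-ascending⇒consecutive 0 (toℕ ∘ f) ascending (λ _ → z≤n) below i ⟩
  toℕ i + 0     ≡⟨ +-identityʳ (toℕ i) ⟩
  toℕ i         ∎)
  where
  open ≡-Reasoning
  ascending : AllPairs _<_ (oneLine f)
  ascending = AllPairs.zipWith (uncurry ≤∧≢⇒<)
    (inversions≡0⇒sorted _ inv≡0 , Unique.tabulate⁺ (f-inj ∘ toℕ-injective))
  below : ∀ i → toℕ (f i) < n + 0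
  below i = subst (toℕ (f i) <_) (sym (+-identityʳ n)) (toℕ<n (f i))

swap-left : ∀ (a b : Fin n) → swap a b a ≡ b
swap-left a b with a ≟ a
... | yes _   = refl
... | no  a≢a = contradiction refl a≢a

swap-right : ∀ (a b : Fin n) → swap a b b ≡ a
swap-right a b with b ≟ a
... | yes b≡a = b≡a
... | no  _ with b ≟ b
...   | yes _   = refl
...   | no  b≢b = contradiction refl b≢b

swap-other : ∀ {a b x : Fin n} → x ≢ a → x ≢ b → swap a b x ≡ x
swap-other {a = a} {b} {x} x≢a x≢b with x ≟ a
... | yes x≡a = contradiction x≡a x≢a
... | no  _ with x ≟ b
...   | yes x≡b = contradiction x≡b x≢b
...   | no  _   = refl

swap-involutive : ∀ (a b x : Fin n) → swap a b (swap a b x) ≡ x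
swap-involutive a b x = by-cases (x ≟ a) (x ≟ b)
  where
  by-cases : Dec (x ≡ a) → Dec (x ≡ b) → swap a b (swap a b x) ≡ x
  by-cases (yes refl) _          = trans (cong (swap x b) (swap-left x b)) (swap-right x b)
  by-cases (no _)     (yes refl) = trans (cong (swap a x) (swap-right a x)) (swap-left a x)
  by-cases (no x≢a)   (no x≢b)   = trans (cong (swap a b) (swap-other x≢a x≢b)) (swap-other x≢a x≢b)

swap-suc : ∀ (a b x : Fin n) → swap (suc a) (suc b) (suc x) ≡ suc (swap a b x)
swap-suc a b x = by-cases (x ≟ a) (x ≟ b)
  where
  by-cases : Dec (x ≡ a) → Dec (x ≡ b) → swap (suc a) (suc b) (suc x) ≡ suc (swap a b x)
  by-cases (yes refl) _          = trans (swap-left (suc x) (suc b)) (cong suc (sym (swap-left x b)))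
  by-cases (no _)     (yes refl) = trans (swap-right (suc a) (suc x)) (cong suc (sym (swap-right a x)))
  by-cases (no x≢a)   (no x≢b)   =
    trans (swap-other {a = suc a} {suc b} (λ { refl → x≢a refl }) (λ { refl → x≢b refl }))
          (cong suc (sym (swap-other x≢a x≢b)))

tabulate-swapAt : (h : Fin n → A) (g : Gen n) → tabulate (h ∘ s g) ≡ swapAt (toℕ (proj₁ g)) (tabulate h)
tabulate-swapAt {suc zero}    h (zero , s≤s ())
tabulate-swapAt {suc (suc n)} h (zero , _) = cong (λ t → h (suc zero) ∷ h zero ∷ t) (tabulate-cong λ _ → refl)
tabulate-swapAt {suc (suc n)} h (suc a , s≤s a+1<n) = cong (h zero ∷_) (begin
  tabulate (h ∘ s (suc a , s≤s a+1<n) ∘ suc)  ≡⟨ tabulate-cong (cong h ∘ swap-suc a _) ⟩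
  tabulate (h ∘ suc ∘ s (a , a+1<n))          ≡⟨ tabulate-swapAt (h ∘ suc) (a , a+1<n) ⟩
  swapAt (toℕ a) (tabulate (h ∘ suc))         ∎)
  where open ≡-Reasoning

s-involutive : (g : Gen n) → s g ∘ s g ≐ id
s-involutive (a , _) = swap-involutive a _

s-injective : (g : Gen n) → Injective _≡_ _≡_ (s g)
s-injective g {x} {y} e = begin
  x             ≡⟨ s-involutive g x ⟨
  s g (s g x)   ≡⟨ cong (s g) e ⟩
  s g (s g y)   ≡⟨ s-involutive g y ⟩
  y             ∎
  where open ≡-Reasoning

eval-injective : (w : List (Gen n)) → Injective _≡_ _≡_ (eval w)
eval-injective []      e = e
eval-injective (g ∷ w) e = eval-injective w (s-injective g e)

eval-∷ʳ : (w : List (Gen n)) (g : Gen n) → eval (w ∷ʳ g) ≐ eval w ∘ s g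
eval-∷ʳ []      g x = refl
eval-∷ʳ (h ∷ w) g x = cong (s h) (eval-∷ʳ w g x)

inversions-∘-eval : (h : Fin n → ℕ) (w : List (Gen n)) →
  inversions (tabulate (h ∘ eval w)) ≤ inversions (tabulate h) + length w
inversions-∘-eval h []      = m≤m+n _ 0
inversions-∘-eval h (g ∷ w) = begin
  inversions (tabulate (h ∘ s g ∘ eval w))             ≤⟨ inversions-∘-eval (h ∘ s g) w ⟩
  inversions (tabulate (h ∘ s g)) + length w
    ≡⟨ cong (λ xs → inversions xs + length w) (tabulate-swapAt h g) ⟩
  inversions (swapAt (toℕ (proj₁ g)) (tabulate h)) + length w
    ≤⟨ +-monoˡ-≤ (length w) (inversions-swapAt-≤ (toℕ (proj₁ g)) (tabulate h)) ⟩
  suc (inversions (tabulate h)) + length w             ≡⟨ +-suc _ (length w) ⟨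
  inversions (tabulate h) + suc (length w)             ∎
  where open ≤-Reasoning

inv≤length : {f : Fun n} (w : List (Gen n)) → eval w ≐ f → inv f ≤ length w
inv≤length {n} {f} w w≐f = begin
  inv f                 ≡⟨ inv-cong w≐f ⟨
  inv (eval w)          ≤⟨ inversions-∘-eval toℕ w ⟩
  inv {n} id + length w ≡⟨ cong (_+ length w) (inv-id {n}) ⟩
  length w              ∎
  where open ≤-Reasoning

descent-generator : (h : Fin n → ℕ) {i : ℕ} → Descent i (tabulate h) → Σ[ g ∈ Gen n ] toℕ (proj₁ g) ≡ i
descent-generator {suc (suc n)} h (here _) = (zero , s≤s (s≤s z≤n)) , refl
descent-generator {suc n}       h (there d) with descent-generator (h ∘ suc) d
... | (a , a+1<n) , refl = (suc a , s≤s a+1<n) , refl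

descent-step : (f : Fun n) → inv f ≢ 0 → Σ[ g ∈ Gen n ] suc (inv (f ∘ s g)) ≡ inv f
descent-step f inv≢0 with descent-exists (oneLine f) inv≢0
... | _ , d with descent-generator (toℕ ∘ f) d
...   | g , refl =
  g , trans (cong (suc ∘ inversions) (tabulate-swapAt (toℕ ∘ f) g)) (inversions-swapAt-descent d)

reduced-word : ∀ k (f : Fun n) → Injective _≡_ _≡_ f → inv f ≡ k → ∃[ w ] (length w ≡ k × eval w ≐ f)
reduced-word zero    f f-inj inv≡0 = [] , refl , sym ∘ inv≡0⇒identity f-inj inv≡0
reduced-word (suc k) f f-inj inv≡k+1 with descent-step f (λ inv≡0 → 0≢1+n (trans (sym inv≡0) inv≡k+1))
... | g , step with reduced-word k (f ∘ s g) (s-injective g ∘ f-inj) (suc-injective (trans step inv≡k+1))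
...   | w , |w|≡k , w≐fg = w ∷ʳ g , |w∷ʳg|≡k+1 , w∷ʳg≐f
  where
  |w∷ʳg|≡k+1 : length (w ∷ʳ g) ≡ suc k
  |w∷ʳg|≡k+1 = trans (length-++ w) (trans (+-comm (length w) 1) (cong suc |w|≡k))
  w∷ʳg≐f : eval (w ∷ʳ g) ≐ f
  w∷ʳg≐f x = begin
    eval (w ∷ʳ g) x   ≡⟨ eval-∷ʳ w g x ⟩
    eval w (s g x)    ≡⟨ w≐fg (s g x) ⟩
    f (s g (s g x))   ≡⟨ cong f (s-involutive g x) ⟩
    f x               ∎
    where open ≡-Reasoning

HasLength⇒Injective : {f : Fun n} {k : ℕ} → HasLength f k → Injective _≡_ _≡_ f
HasLength⇒Injective ((w , _ , w≐f) , _) = Injective-resp-≐ w≐f (eval-injective w)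

hasLength-inv : {f : Fun n} → Injective _≡_ _≡_ f → HasLength f (inv f)
hasLength-inv {f = f} f-inj = reduced-word _ f f-inj refl , inv≤length

HasLength-functional : {f : Fun n} {a b : ℕ} → HasLength f a → HasLength f b → a ≡ b
HasLength-functional {a = a} {b} ((w , |w|≡a , w≐f) , a-minimal) ((v , |v|≡b , v≐f) , b-minimal) =
  ≤-antisym (subst (a ≤_) |v|≡b (a-minimal v v≐f)) (subst (b ≤_) |w|≡a (b-minimal w w≐f))

HasLength⇒≡inv : {f : Fun n} {k : ℕ} → HasLength f k → k ≡ inv f
HasLength⇒≡inv ℓf = HasLength-functional ℓf (hasLength-inv (HasLength⇒Injective ℓf))

≤w⇒inv-+ : {ω σ : Fun n} → ω ≤w σ →
  ∃[ α ] (Injective _≡_ _≡_ α × σ ≐ α ∘ ω × inv σ ≡ inv α + inv ω)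
≤w⇒inv-+ {ω = ω} {σ} (α , a , b , ℓα , ℓω , ℓσ , σ≐αω) =
  α , HasLength⇒Injective ℓα , σ≐αω , (begin
  inv σ          ≡⟨ HasLength⇒≡inv ℓσ ⟨
  a + b          ≡⟨ cong₂ _+_ (HasLength⇒≡inv ℓα) (HasLength⇒≡inv ℓω) ⟩
  inv α + inv ω  ∎)
  where open ≡-Reasoning

inv-+⇒≤w : {α ω σ : Fun n} → Injective _≡_ _≡_ α → Injective _≡_ _≡_ ω →
  σ ≐ α ∘ ω → inv σ ≡ inv α + inv ω → ω ≤w σ
inv-+⇒≤w {α = α} {ω} {σ} α-inj ω-inj σ≐αω inv-σ =
  α , inv α , inv ω , hasLength-inv α-inj , hasLength-inv ω-inj ,
  subst (HasLength σ) inv-σ (hasLength-inv (Injective-resp-≐ (sym ∘ σ≐αω) (ω-inj ∘ α-inj))) , σ≐αω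

Sum-map-injective : {f : A → C} {g : B → D} → Injective _≡_ _≡_ f → Injective _≡_ _≡_ g →
  Injective _≡_ _≡_ (Sum.map f g)
Sum-map-injective f-inj _ {inj₁ _} {inj₁ _} e = cong inj₁ (f-inj (inj₁-injective e))
Sum-map-injective _ g-inj {inj₂ _} {inj₂ _} e = cong inj₂ (g-inj (inj₂-injective e))
Sum-map-injective _ _     {inj₁ _} {inj₂ _} ()
Sum-map-injective _ _     {inj₂ _} {inj₁ _} ()

infixr 6 _⊕_
_⊕_ : Fun p → Fun m → Fun (p + m)
_⊕_ {p} {m} α γ = join p m ∘ Sum.map α γ ∘ splitAt p

⊕-↑ˡ : (α : Fun p) (γ : Fun m) (i : Fin p) → (α ⊕ γ) (i ↑ˡ m) ≡ α i ↑ˡ m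
⊕-↑ˡ {p} {m} α γ i = cong (join p m ∘ Sum.map α γ) (splitAt-↑ˡ p i m)

⊕-↑ʳ : (α : Fun p) (γ : Fun m) (j : Fin m) → (α ⊕ γ) (p ↑ʳ j) ≡ p ↑ʳ γ j
⊕-↑ʳ {p} {m} α γ j = cong (join p m ∘ Sum.map α γ) (splitAt-↑ʳ p m j)

⊕-injective : {α : Fun p} {γ : Fun m} → Injective _≡_ _≡_ α → Injective _≡_ _≡_ γ →
  Injective _≡_ _≡_ (α ⊕ γ)
⊕-injective {p} {m} {α} {γ} α-inj γ-inj {i} {j} e = begin
  i                       ≡⟨ join-splitAt p m i ⟨
  join p m (splitAt p i)
    ≡⟨ cong (join p m) (Sum-map-injective α-inj γ-inj {splitAt p i} {splitAt p j} (join-injective _ _ e)) ⟩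
  join p m (splitAt p j)  ≡⟨ join-splitAt p m j ⟩
  j                       ∎
  where
  open ≡-Reasoning
  join-injective : ∀ x y → join p m x ≡ join p m y → x ≡ y
  join-injective x y e′ =
    trans (sym (splitAt-join p m x)) (trans (cong (splitAt p) e′) (splitAt-join p m y))

tabulate-+ : ∀ p (h : Fin (p + m) → A) → tabulate h ≡ tabulate (h ∘ (_↑ˡ m)) ++ tabulate (h ∘ (p ↑ʳ_))
tabulate-+ zero    h = refl
tabulate-+ (suc p) h = cong (h zero ∷_) (tabulate-+ p (h ∘ suc))

tabulate-∷ʳ : (h : Fin (suc n) → A) → tabulate h ≡ tabulate (h ∘ inject₁) ∷ʳ h (fromℕ n)
tabulate-∷ʳ {zero}  h = refl
tabulate-∷ʳ {suc n} h = cong (h zero ∷_) (tabulate-∷ʳ (h ∘ suc))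

oneLine-⊕ : (α : Fun p) (γ : Fun m) → oneLine (α ⊕ γ) ≡ oneLine α ++ map (p +_) (oneLine γ)
oneLine-⊕ {p} {m} α γ = begin
  oneLine (α ⊕ γ)
    ≡⟨ tabulate-+ p _ ⟩
  tabulate (toℕ ∘ (α ⊕ γ) ∘ (_↑ˡ m)) ++ tabulate (toℕ ∘ (α ⊕ γ) ∘ (p ↑ʳ_))
    ≡⟨ cong₂ _++_ (tabulate-cong left) (tabulate-cong right) ⟩
  oneLine α ++ tabulate ((p +_) ∘ toℕ ∘ γ)
    ≡⟨ cong (oneLine α ++_) (map-tabulate (toℕ ∘ γ) (p +_)) ⟨
  oneLine α ++ map (p +_) (oneLine γ) ∎
  where
  open ≡-Reasoning
  left : ∀ i → toℕ ((α ⊕ γ) (i ↑ˡ m)) ≡ toℕ (α i)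
  left i = trans (cong toℕ (⊕-↑ˡ α γ i)) (toℕ-↑ˡ (α i) m)
  right : ∀ j → toℕ ((α ⊕ γ) (p ↑ʳ j)) ≡ p + toℕ (γ j)
  right j = trans (cong toℕ (⊕-↑ʳ α γ j)) (toℕ-↑ʳ p (γ j))

inv-⊕ : (α : Fun p) (γ : Fun m) → inv (α ⊕ γ) ≡ inv α + inv γ
inv-⊕ {p} α γ = begin
  inv (α ⊕ γ)                                       ≡⟨ cong inversions (oneLine-⊕ α γ) ⟩
  inversions (oneLine α ++ map (p +_) (oneLine γ))  ≡⟨ inversions-++ (oneLine<n α) p≤shifted ⟩
  inv α + inversions (map (p +_) (oneLine γ))       ≡⟨ cong (inv α +_) (inversions-map-+ p (oneLine γ)) ⟩
  inv α + inv γ                                     ∎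
  where
  open ≡-Reasoning
  p≤shifted : All (p ≤_) (map (p +_) (oneLine γ))
  p≤shifted = All.map⁺ (All.tabulate⁺ (λ j → m≤m+n p (toℕ (γ j))))

extend : Fun q → Fun (suc q)
extend {q} β i with q ℕ.≟ toℕ i
... | yes _   = fromℕ q
... | no  q≢i = inject₁ (β (lower₁ i q≢i))

extend-fromℕ : (β : Fun q) → extend β (fromℕ q) ≡ fromℕ q
extend-fromℕ {q} β with q ℕ.≟ toℕ (fromℕ q)
... | yes _   = refl
... | no  q≢q = contradiction (sym (toℕ-fromℕ q)) q≢q

extend-inject₁ : (β : Fun q) (j : Fin q) → extend β (inject₁ j) ≡ inject₁ (β j)
extend-inject₁ {q} β j with q ℕ.≟ toℕ (inject₁ j)
... | yes q≡j = contradiction q≡j (toℕ-inject₁-≢ j)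
... | no  q≢j = cong (inject₁ ∘ β) (lower₁-inject₁′ j q≢j)

extend-injective : {β : Fun q} → Injective _≡_ _≡_ β → Injective _≡_ _≡_ (extend β)
extend-injective {q} β-inj {i} {j} e with q ℕ.≟ toℕ i | q ℕ.≟ toℕ j
... | yes q≡i | yes q≡j = toℕ-injective (trans (sym q≡i) q≡j)
... | yes _   | no  _   = contradiction e fromℕ≢inject₁
... | no  _   | yes _   = contradiction (sym e) fromℕ≢inject₁
... | no  _   | no  _   = lower₁-injective (β-inj (inject₁-injective e))

oneLine-extend : (β : Fun q) → oneLine (extend β) ≡ oneLine β ∷ʳ q
oneLine-extend {q} β = trans (tabulate-∷ʳ (toℕ ∘ extend β)) (cong₂ _∷ʳ_ (tabulate-cong inner) last)
  where
  inner : ∀ j → toℕ (extend β (inject₁ j)) ≡ toℕ (β j)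
  inner j = trans (cong toℕ (extend-inject₁ β j)) (toℕ-inject₁ (β j))
  last : toℕ (extend β (fromℕ q)) ≡ q
  last = trans (cong toℕ (extend-fromℕ β)) (toℕ-fromℕ q)

inv-extend : (β : Fun q) → inv (extend β) ≡ inv β
inv-extend {q} β = begin
  inv (extend β)               ≡⟨ cong inversions (oneLine-extend β) ⟩
  inversions (oneLine β ∷ʳ q)  ≡⟨ inversions-++ (oneLine<n β) (≤-refl ∷ []) ⟩
  inv β + 0                    ≡⟨ +-identityʳ (inv β) ⟩
  inv β                        ∎
  where open ≡-Reasoning

ε : Fun 0
ε ()

graft-⊕ : (σ : Fun p) (τ : Fun q) → graft σ τ ≐ σ ⊕ graft ε τ
graft-⊕ {p} σ τ i with splitAt p i
... | inj₁ _       = refl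
... | inj₂ zero    = refl
... | inj₂ (suc _) = refl

graft-ε-injective : {τ : Fun q} → Injective _≡_ _≡_ τ → Injective _≡_ _≡_ (graft ε τ)
graft-ε-injective τ-inj {zero}  {zero}  _ = refl
graft-ε-injective τ-inj {zero}  {suc _} e = contradiction e fromℕ≢inject₁
graft-ε-injective τ-inj {suc _} {zero}  e = contradiction (sym e) fromℕ≢inject₁
graft-ε-injective τ-inj {suc _} {suc _} e = cong suc (τ-inj (inject₁-injective e))

inv-graft-ε : (τ : Fun q) → inv (graft ε τ) ≡ q + inv τ
inv-graft-ε {q} τ = begin
  inv (graft ε τ)                                    ≡⟨ cong inversions oneLine-graft-ε ⟩
  countBelow q (oneLine τ) + inv τ                   ≡⟨ cong (_+ inv τ) (countBelow-< (oneLine<n τ)) ⟩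
  length (oneLine τ) + inv τ                         ≡⟨ cong (_+ inv τ) (length-tabulate (toℕ ∘ τ)) ⟩
  q + inv τ                                          ∎
  where
  open ≡-Reasoning
  oneLine-graft-ε : oneLine (graft ε τ) ≡ q ∷ oneLine τ
  oneLine-graft-ε = cong₂ _∷_ (toℕ-fromℕ q) (tabulate-cong (toℕ-inject₁ ∘ τ))

graft-injective : {σ : Fun p} {τ : Fun q} → Injective _≡_ _≡_ σ → Injective _≡_ _≡_ τ →
  Injective _≡_ _≡_ (graft σ τ)
graft-injective {σ = σ} {τ} σ-inj τ-inj =
  Injective-resp-≐ (sym ∘ graft-⊕ σ τ) (⊕-injective σ-inj (graft-ε-injective τ-inj))

inv-graft : (σ : Fun p) (τ : Fun q) → inv (graft σ τ) ≡ inv σ + (q + inv τ)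
inv-graft σ τ =
  trans (inv-cong (graft-⊕ σ τ)) (trans (inv-⊕ σ (graft ε τ)) (cong (inv σ +_) (inv-graft-ε τ)))

graft-∘ : {σ σ′ α : Fun p} {τ τ′ β : Fun q} → σ′ ≐ α ∘ σ → τ′ ≐ β ∘ τ →
  graft σ′ τ′ ≐ (α ⊕ extend β) ∘ graft σ τ
graft-∘ {p} {q} {σ = σ} {α = α} {τ = τ} {β = β} σ′≐ασ τ′≐βτ i with splitAt p i
... | inj₁ j       = trans (cong (_↑ˡ suc q) (σ′≐ασ j)) (sym (⊕-↑ˡ α (extend β) (σ j)))
... | inj₂ zero    = trans (cong (p ↑ʳ_) (sym (extend-fromℕ β))) (sym (⊕-↑ʳ α (extend β) (fromℕ q)))
... | inj₂ (suc j) =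
  trans (cong (p ↑ʳ_) (trans (cong inject₁ (τ′≐βτ j)) (sym (extend-inject₁ β (τ j)))))
        (sym (⊕-↑ʳ α (extend β) (inject₁ (τ j))))

lemma1p7 : (p q : ℕ) (σ σ′ : Fun p) (τ τ′ : Fun q) →
    Bijective _≡_ _≡_ σ → Bijective _≡_ _≡_ σ′ →
    Bijective _≡_ _≡_ τ → Bijective _≡_ _≡_ τ′ →
    σ ≤w σ′ → τ ≤w τ′ → graft σ τ ≤w graft σ′ τ′
lemma1p7 p q σ σ′ τ τ′ (σ-inj , _) _ (τ-inj , _) _ σ≤σ′ τ≤τ′
  with ≤w⇒inv-+ σ≤σ′ | ≤w⇒inv-+ τ≤τ′
... | α , α-inj , σ′≐ασ , inv-σ′ | β , β-inj , τ′≐βτ , inv-τ′ =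
  inv-+⇒≤w (⊕-injective α-inj (extend-injective β-inj)) (graft-injective σ-inj τ-inj)
    (graft-∘ σ′≐ασ τ′≐βτ) (begin
      inv (graft σ′ τ′)                         ≡⟨ inv-graft σ′ τ′ ⟩
      inv σ′ + (q + inv τ′)                     ≡⟨ cong₂ (λ a b → a + (q + b)) inv-σ′ inv-τ′ ⟩
      (inv α + inv σ) + (q + (inv β + inv τ))   ≡⟨ interchange (inv α) (inv σ) (inv β) (inv τ) q ⟩
      (inv α + inv β) + (inv σ + (q + inv τ))   ≡⟨ cong₂ _+_ inv-α⊕β (inv-graft σ τ) ⟨
      inv (α ⊕ extend β) + inv (graft σ τ)      ∎)
  where
  open ≡-Reasoning
  interchange : ∀ a b c d q → (a + b) + (q + (c + d)) ≡ (a + c) + (b + (q + d))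
  interchange = solve-∀
  inv-α⊕β : inv (α ⊕ extend β) ≡ inv α + inv β
  inv-α⊕β = trans (inv-⊕ α (extend β)) (cong (inv α +_) (inv-extend β))
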